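{- Let $q$ be a non-degenerate isotropic quadratic form over a finite field $F$ with $f$ elements, and for $i\in\{1,2\}$ let $t_i$ be the number of totally isotropic subspaces of dimension $i$. For $k\in\{1,2\}$ let $c_k$ be the number of cycles of length $3$ in $\mathcal{G}_{q,0}$ of the form $(0,v,w,0)$ with $\dim\operatorname{span}(v,w)=k$. Then $c_1=t_1\binom{f-1}{2}$ and $c_2=t_2\cdot\frac{(f^2-1)(f^2-f)}{2}$.
   Context: A quadratic form on a finite-dimensional $F$-vector space $V$ is a map $q:V\to F$ with $q(\lambda x)=\lambda^2q(x)$ such that $b_q(x,y)=q(x+y)-q(x)-q(y)$ is bilinear; non-degenerate means $\{x: b_q(x,y)=0\ \forall y\}=\{0\}$; isotropic means $q(v)=0$ for some $v\ne0$. A subspace $W$ is totally isotropic if $q|_W=0$. The representation graph $\mathcal{G}_{q,0}$ has vertex set $V$, with distinct $x,y$ adjacent iff $q(x-y)=0$. Cycles of length 3 (triangles) are counted as subgraphs, i.e. as unordered vertex sets. -}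

module Defs where

open import Level using (Level; _⊔_; 0ℓ)
open import Data.Nat using (ℕ; zero; suc)
open import Data.Fin using (Fin)
import Data.Fin as Fin
open import Data.Product using (Σ; ∃; _×_; _,_)
open import Data.Sum using (_⊎_)
open import Relation.Nullary using (¬_)
open import Relation.Binary.PropositionalEquality using (_≡_)
open import Function.Bundles using (_⇔_)
open import Algebra.Bundles using (CommutativeRing)

-- A counting of a type A up to a relation _~_ (intended to be an
-- equivalence): a bijection between A/~ and Fin n.
record Counts {a ℓ : Level} {A : Set a} (_~_ : A → A → Set ℓ) (n : ℕ) : Set (a ⊔ ℓ) where
  field
    to      : A → Fin n
    from    : Fin n → A
    to-cong : ∀ {x y} → x ~ y → to x ≡ to y
    to-from : ∀ i → to (from i) ≡ i
    from-to : ∀ x → from (to x) ~ x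

record FiniteField (c ℓ : Level) (f : ℕ) : Set (Level.suc (c ⊔ ℓ)) where
  field
    commRing : CommutativeRing c ℓ
  open CommutativeRing commRing public
  field
    0≉1     : ¬ (0# ≈ 1#)
    inverse : ∀ x → ¬ (x ≈ 0#) → Σ Carrier λ y → x * y ≈ 1#
    finite  : Counts _≈_ f

module VectorSpace {c ℓ : Level} {f : ℕ} (F : FiniteField c ℓ f) (n : ℕ) where
  open FiniteField F

  -- the n-dimensional F-vector space F^n (every finite-dimensional
  -- F-vector space is isomorphic to one of these)
  V : Set c
  V = Fin n → Carrier

  _≈ⱽ_ : V → V → Set ℓ
  x ≈ⱽ y = ∀ i → x i ≈ y i

  0ⱽ : V
  0ⱽ _ = 0#

  _+ⱽ_ : V → V → V
  (x +ⱽ y) i = x i + y i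

  _-ⱽ_ : V → V → V
  (x -ⱽ y) i = x i - y i

  _·_ : Carrier → V → V
  (λ' · x) i = λ' * x i

  lincomb : ∀ {k} → (Fin k → Carrier) → (Fin k → V) → V
  lincomb {zero}  a v = 0ⱽ
  lincomb {suc k} a v = (a Fin.zero · v Fin.zero) +ⱽ lincomb (λ i → a (Fin.suc i)) (λ i → v (Fin.suc i))

  LinIndep : ∀ {k} → (Fin k → V) → Set (c ⊔ ℓ)
  LinIndep {k} v = ∀ (a : Fin k → Carrier) → lincomb a v ≈ⱽ 0ⱽ → ∀ i → a i ≈ 0#

  InSpan : ∀ {k} → (Fin k → V) → V → Set (c ⊔ ℓ)
  InSpan {k} v x = Σ (Fin k → Carrier) λ a → x ≈ⱽ lincomb a v

  IsSubspaceOfDim : (V → Set (c ⊔ ℓ)) → ℕ → Set (c ⊔ ℓ)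
  IsSubspaceOfDim P k = Σ (Fin k → V) λ b → LinIndep b × (∀ x → P x ⇔ InSpan b x)

  DimSpan : ∀ {k} → (Fin k → V) → ℕ → Set (c ⊔ ℓ)
  DimSpan v d = IsSubspaceOfDim (InSpan v) d

  pair : V → V → Fin 2 → V
  pair v w Fin.zero       = v
  pair v w (Fin.suc _)    = w

  record QuadraticForm : Set (c ⊔ ℓ) where
    field
      q       : V → Carrier
      q-cong  : ∀ {x y} → x ≈ⱽ y → q x ≈ q y
      q-homog : ∀ λ' x → q (λ' · x) ≈ (λ' * λ') * q x
    b : V → V → Carrier
    b x y = q (x +ⱽ y) - q x - q y
    field
      b-addˡ  : ∀ x x' y → b (x +ⱽ x') y ≈ b x y + b x' y
      b-addʳ  : ∀ x y y' → b x (y +ⱽ y') ≈ b x y + b x y'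
      b-homˡ  : ∀ λ' x y → b (λ' · x) y ≈ λ' * b x y
      b-homʳ  : ∀ λ' x y → b x (λ' · y) ≈ λ' * b x y

  module _ (Q : QuadraticForm) where
    open QuadraticForm Q

    NonDegenerate : Set (c ⊔ ℓ)
    NonDegenerate = ∀ x → (∀ y → b x y ≈ 0#) → x ≈ⱽ 0ⱽ

    Isotropic : Set (c ⊔ ℓ)
    Isotropic = Σ V λ v → ¬ (v ≈ⱽ 0ⱽ) × q v ≈ 0#

    TotallyIsotropic : (V → Set (c ⊔ ℓ)) → Set (c ⊔ ℓ)
    TotallyIsotropic P = ∀ x → P x → q x ≈ 0#

    TISubspace : ℕ → Set (Level.suc (c ⊔ ℓ))
    TISubspace i = Σ (V → Set (c ⊔ ℓ)) λ P → IsSubspaceOfDim P i × TotallyIsotropic P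

    _≈ˢ_ : ∀ {i} → TISubspace i → TISubspace i → Set (c ⊔ ℓ)
    (P , _) ≈ˢ (P' , _) = ∀ x → P x ⇔ P' x

    -- adjacency in the representation graph G_{q,0}
    Adj : V → V → Set ℓ
    Adj x y = ¬ (x ≈ⱽ y) × q (x -ⱽ y) ≈ 0#

    Triangle : ℕ → Set (c ⊔ ℓ)
    Triangle k = Σ V λ v → Σ V λ w →
      Adj 0ⱽ v × Adj v w × Adj w 0ⱽ × DimSpan (pair v w) k

    -- triangles are counted as unordered vertex sets {0,v,w}
    _≈ᵗ_ : ∀ {k} → Triangle k → Triangle k → Set ℓ
    (v , w , _) ≈ᵗ (v' , w' , _) = (v ≈ⱽ v' × w ≈ⱽ w') ⊎ (v ≈ⱽ w' × w ≈ⱽ v')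

{-# OPTIONS --safe #-}
module Submission where

-- A triangle (0 , v , w) is a pair of distinct nonzero vectors with q v = q w = q (v - w) = 0. By
-- polarisation b v w = 0, so span(v , w) is a totally isotropic subspace W, of dimension k, and {v , w}
-- is an unordered pair spanning W. Coordinates in a basis of W identify these pairs with the unordered
-- pairs {x , y} of distinct nonzero vectors spanning Fᵏ, independently of W, so c_k is t_k times the
-- number of such pairs. For k = 1 they are the pairs of distinct elements of F×: C(f - 1, 2). For
-- k = 2 they are the pairs with det(x , y) ≠ 0. Writing a nonzero vector as a nonzero multiple of a
-- fixed representative of its line in ℙ¹(F), these are the unordered pairs of distinct lines with a
-- nonzero scalar on each: C(f + 1, 2) · (f - 1)² = (f² - 1)(f² - f) / 2.

open import Defs
open import Level using (Level)
open import Algebra.Bundles using (CommutativeRing)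
open import Data.Nat as ℕ using (ℕ; zero; suc)
import Data.Nat.Properties as ℕ
open import Data.Fin as Fin using (Fin; zero; suc)
import Data.Fin.Properties as Fin
open import Data.Product using (Σ; _×_; _,_; proj₁; proj₂; uncurry; map)
open import Data.Product.Relation.Binary.Pointwise.NonDependent using (Pointwise; ≡×≡⇒≡; ≡⇒≡×≡)
open import Data.Sum using (_⊎_; inj₁; inj₂)
open import Data.Unit.Polymorphic using (⊤)
open import Data.Empty.Irrelevant using (⊥-elim)
open import Data.Vec.Functional using ([]; _∷_)
open import Function using (_on_; _∘_; _$_)
open import Function.Bundles using (_⇔_; mk⇔; Equivalence)
import Function.Properties.Equivalence as ⇔
open import Relation.Nullary using (¬_; yes; no)
open import Relation.Binary using (Rel; Decidable; IsEquivalence; tri<; tri≈; tri>)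
import Relation.Binary.Construct.On as On
open import Relation.Binary.PropositionalEquality as ≡ using (_≡_; _≢_)

-- The ring solver over an arbitrary commutative ring needs integer
-- coefficients, i.e. the canonical homomorphism ℤ → R.
module IntegerCoefficientSolver {c ℓ : Level} (R : CommutativeRing c ℓ) where
  open import Data.Integer as ℤ using (ℤ; +_; -[1+_]; _⊖_)
  import Data.Integer.Properties as ℤ
  import Data.Sign as Sign
  open import Data.Maybe using (Maybe; nothing; just)
  open import Algebra.Solver.Ring.AlmostCommutativeRing using (fromCommutativeRing; _-Raw-AlmostCommutative⟶_)
  open CommutativeRing R
  open import Algebra.Properties.Ring ring using (-0#≈0#; -‿involutive; -‿+-comm; -‿distribˡ-*; -‿distribʳ-*)
  open import Algebra.Properties.Semiring.Mult.TCOptimised semiring using (×-homo-+; ×1-homo-*) renaming (_×_ to _×′_)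
  open import Algebra.Properties.CommutativeSemigroup *-commutativeSemigroup using (interchange)
  open import Relation.Binary.Reasoning.Setoid setoid

  ⟦_⟧ℕ : ℕ → Carrier
  ⟦ n ⟧ℕ = n ×′ 1#

  ⟦_⟧ˢ : Sign.Sign → Carrier
  ⟦ Sign.+ ⟧ˢ = 1#
  ⟦ Sign.- ⟧ˢ = - 1#

  ⟦_⟧ℤ : ℤ → Carrier
  ⟦ + n ⟧ℤ      = ⟦ n ⟧ℕ
  ⟦ -[1+ n ] ⟧ℤ = - ⟦ suc n ⟧ℕ

  ⟦suc⟧ : ∀ m → ⟦ suc m ⟧ℕ ≈ 1# + ⟦ m ⟧ℕ
  ⟦suc⟧ m = ×-homo-+ 1# 1 m

  x-0≈x : ∀ x → x - 0# ≈ x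
  x-0≈x x = trans (+-congˡ -0#≈0#) (+-identityʳ x)

  x-y≈[1+x]-[1+y] : ∀ x y → x - y ≈ (1# + x) - (1# + y)
  x-y≈[1+x]-[1+y] x y = begin
    x - y                     ≈⟨ sym (+-identityˡ _) ⟩
    0# + (x - y)              ≈⟨ +-congʳ (sym (-‿inverseʳ 1#)) ⟩
    (1# - 1#) + (x - y)       ≈⟨ +-assoc 1# (- 1#) (x - y) ⟩
    1# + (- 1# + (x - y))     ≈⟨ +-congˡ (sym (+-assoc (- 1#) x (- y))) ⟩
    1# + ((- 1# + x) - y)     ≈⟨ +-congˡ (+-congʳ (+-comm (- 1#) x)) ⟩
    1# + ((x - 1#) - y)       ≈⟨ +-congˡ (+-assoc x (- 1#) (- y)) ⟩
    1# + (x + (- 1# - y))     ≈⟨ sym (+-assoc 1# x _) ⟩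
    (1# + x) + (- 1# - y)     ≈⟨ +-congˡ (-‿+-comm 1# y) ⟩
    (1# + x) - (1# + y)       ∎

  ⊖-homo : ∀ m n → ⟦ m ⊖ n ⟧ℤ ≈ ⟦ m ⟧ℕ - ⟦ n ⟧ℕ
  ⊖-homo zero    zero    = sym (-‿inverseʳ 0#)
  ⊖-homo (suc m) zero    = sym (x-0≈x _)
  ⊖-homo zero    (suc n) = sym (+-identityˡ _)
  ⊖-homo (suc m) (suc n) = begin
    ⟦ suc m ⊖ suc n ⟧ℤ                 ≡⟨ ≡.cong ⟦_⟧ℤ (ℤ.[1+m]⊖[1+n]≡m⊖n m n) ⟩
    ⟦ m ⊖ n ⟧ℤ                         ≈⟨ ⊖-homo m n ⟩
    ⟦ m ⟧ℕ - ⟦ n ⟧ℕ                    ≈⟨ x-y≈[1+x]-[1+y] ⟦ m ⟧ℕ ⟦ n ⟧ℕ ⟩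
    (1# + ⟦ m ⟧ℕ) - (1# + ⟦ n ⟧ℕ)      ≈⟨ sym (+-cong (⟦suc⟧ m) (-‿cong (⟦suc⟧ n))) ⟩
    ⟦ suc m ⟧ℕ - ⟦ suc n ⟧ℕ            ∎

  +-homo : ∀ i j → ⟦ i ℤ.+ j ⟧ℤ ≈ ⟦ i ⟧ℤ + ⟦ j ⟧ℤ
  +-homo (+ m)    (+ n)    = ×-homo-+ 1# m n
  +-homo (+ m)    -[1+ n ] = ⊖-homo m (suc n)
  +-homo -[1+ m ] (+ n)    = trans (⊖-homo n (suc m)) (+-comm _ _)
  +-homo -[1+ m ] -[1+ n ] = begin
    - ⟦ suc (suc (m ℕ.+ n)) ⟧ℕ          ≈⟨ -‿cong (⟦suc⟧ (suc (m ℕ.+ n))) ⟩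
    - (1# + ⟦ suc m ℕ.+ n ⟧ℕ)           ≈⟨ -‿cong (+-congˡ (×-homo-+ 1# (suc m) n)) ⟩
    - (1# + (⟦ suc m ⟧ℕ + ⟦ n ⟧ℕ))      ≈⟨ -‿cong (sym (+-assoc _ _ _)) ⟩
    - ((1# + ⟦ suc m ⟧ℕ) + ⟦ n ⟧ℕ)      ≈⟨ -‿cong (+-congʳ (+-comm _ _)) ⟩
    - ((⟦ suc m ⟧ℕ + 1#) + ⟦ n ⟧ℕ)      ≈⟨ -‿cong (+-assoc _ _ _) ⟩
    - (⟦ suc m ⟧ℕ + (1# + ⟦ n ⟧ℕ))      ≈⟨ -‿cong (+-congˡ (sym (⟦suc⟧ n))) ⟩
    - (⟦ suc m ⟧ℕ + ⟦ suc n ⟧ℕ)         ≈⟨ sym (-‿+-comm _ _) ⟩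
    - ⟦ suc m ⟧ℕ + - ⟦ suc n ⟧ℕ         ∎

  sign-abs : ∀ i → ⟦ i ⟧ℤ ≈ ⟦ ℤ.sign i ⟧ˢ * ⟦ ℤ.∣ i ∣ ⟧ℕ
  sign-abs (+ n)    = sym (*-identityˡ _)
  sign-abs -[1+ n ] = trans (-‿cong (sym (*-identityˡ _))) (-‿distribˡ-* 1# _)

  ◃-homo : ∀ s n → ⟦ s ℤ.◃ n ⟧ℤ ≈ ⟦ s ⟧ˢ * ⟦ n ⟧ℕ
  ◃-homo s       zero    = sym (zeroʳ _)
  ◃-homo Sign.+ (suc n) = sym (*-identityˡ _)
  ◃-homo Sign.- (suc n) = sign-abs -[1+ n ]

  sign-homo : ∀ s t → ⟦ s Sign.* t ⟧ˢ ≈ ⟦ s ⟧ˢ * ⟦ t ⟧ˢ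
  sign-homo Sign.+ t      = sym (*-identityˡ _)
  sign-homo Sign.- Sign.+ = sym (*-identityʳ _)
  sign-homo Sign.- Sign.- = begin
    1#             ≈⟨ sym (-‿involutive 1#) ⟩
    - - 1#         ≈⟨ -‿cong (sym (*-identityʳ _)) ⟩
    - (- 1# * 1#)  ≈⟨ -‿distribʳ-* (- 1#) 1# ⟩
    - 1# * - 1#    ∎

  *-homo : ∀ i j → ⟦ i ℤ.* j ⟧ℤ ≈ ⟦ i ⟧ℤ * ⟦ j ⟧ℤ
  *-homo i j = begin
    ⟦ i ℤ.* j ⟧ℤ                  ≈⟨ ◃-homo (ℤ.sign i Sign.* ℤ.sign j) (∣i∣ ℕ.* ∣j∣) ⟩
    ⟦ ℤ.sign i Sign.* ℤ.sign j ⟧ˢ * ⟦ ∣i∣ ℕ.* ∣j∣ ⟧ℕ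
                                  ≈⟨ *-cong (sign-homo (ℤ.sign i) (ℤ.sign j)) (×1-homo-* ∣i∣ ∣j∣) ⟩
    (s * t) * (⟦ ∣i∣ ⟧ℕ * ⟦ ∣j∣ ⟧ℕ)  ≈⟨ interchange s t _ _ ⟩
    (s * ⟦ ∣i∣ ⟧ℕ) * (t * ⟦ ∣j∣ ⟧ℕ)  ≈⟨ *-cong (sym (sign-abs i)) (sym (sign-abs j)) ⟩
    ⟦ i ⟧ℤ * ⟦ j ⟧ℤ                ∎
    where
    ∣i∣ = ℤ.∣ i ∣
    ∣j∣ = ℤ.∣ j ∣
    s = ⟦ ℤ.sign i ⟧ˢ
    t = ⟦ ℤ.sign j ⟧ˢ

  -‿homo : ∀ i → ⟦ ℤ.- i ⟧ℤ ≈ - ⟦ i ⟧ℤ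
  -‿homo (+ zero)  = sym -0#≈0#
  -‿homo (+ suc n) = refl
  -‿homo -[1+ n ]  = sym (-‿involutive _)

  ℤ⟶R : ℤ.+-*-rawRing -Raw-AlmostCommutative⟶ fromCommutativeRing R
  ℤ⟶R = record
    { ⟦_⟧ = ⟦_⟧ℤ ; +-homo = +-homo ; *-homo = *-homo ; -‿homo = -‿homo
    ; 0-homo = refl ; 1-homo = refl }

  ℤ-weaklyDecidable : ∀ i j → Maybe (⟦ i ⟧ℤ ≈ ⟦ j ⟧ℤ)
  ℤ-weaklyDecidable i j with i ℤ.≟ j
  ... | yes ≡.refl = just refl
  ... | no _       = nothing

  open import Algebra.Solver.Ring ℤ.+-*-rawRing (fromCommutativeRing R) ℤ⟶R ℤ-weaklyDecidable public

  :0 :1 : ∀ {n} → Polynomial n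
  :0 = con (ℤ.+ 0)
  :1 = con (ℤ.+ 1)

module Counting where
  open import Data.Nat using (_+_; _*_; s≤s; z≤n)
  open import Data.Fin using (_<_; _↑ˡ_; _↑ʳ_; splitAt; punchIn; punchOut; combine; remQuot)
  open import Data.Fin.Properties using (<-cmp)
  open ≡ using (refl; sym; trans; cong; cong₂; subst; module ≡-Reasoning)

  private
    variable
      a b r s : Level
      A B X : Set a
      m n : ℕ

  Counts-unique : {_~_ : Rel A r} → Counts _~_ m → Counts _~_ n → m ≡ n
  Counts-unique C D =
    ℕ.≤-antisym (Fin.injective⇒≤ (compose-injective C D)) (Fin.injective⇒≤ (compose-injective D C))
    where
    compose-injective : ∀ {m n} (C : Counts _ m) (D : Counts _ n) → ∀ {i j} →
                        Counts.to D (Counts.from C i) ≡ Counts.to D (Counts.from C j) → i ≡ j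
    compose-injective C D {i} {j} e = begin
      i                                ≡⟨ sym (C.to-from i) ⟩
      C.to (C.from i)                  ≡⟨ sym (C.to-cong (D.from-to (C.from i))) ⟩
      C.to (D.from (D.to (C.from i)))  ≡⟨ cong (C.to ∘ D.from) e ⟩
      C.to (D.from (D.to (C.from j)))  ≡⟨ C.to-cong (D.from-to (C.from j)) ⟩
      C.to (C.from j)                  ≡⟨ C.to-from j ⟩
      j                                ∎
      where
      module C = Counts C
      module D = Counts D
      open ≡-Reasoning

  module _ {_~_ : Rel A r} (C : Counts _~_ n) where
    open Counts C

    Counts-from-injective : ∀ {i j} → from i ~ from j → i ≡ j
    Counts-from-injective {i} {j} e = trans (sym (to-from i)) (trans (to-cong e) (to-from j))

    Counts-to-injective : IsEquivalence _~_ → ∀ {x y} → to x ≡ to y → x ~ y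
    Counts-to-injective ~-equiv {x} {y} e =
      ~-trans (~-sym (from-to x)) (subst (λ i → from i ~ y) (sym e) (from-to y))
      where open IsEquivalence ~-equiv renaming (sym to ~-sym; trans to ~-trans)

  -- The last hypothesis merges congruence of ψ with ψ ∘ φ ≈ id, so that _≈_ need not be transitive.
  Counts-transfer : {_~_ : Rel A r} {_≈_ : Rel B s} (φ : B → A) (ψ : A → B) →
                    (∀ {x y} → x ≈ y → φ x ~ φ y) → (∀ u → φ (ψ u) ~ u) →
                    (∀ {x u} → u ~ φ x → ψ u ≈ x) →
                    Counts _~_ n → Counts _≈_ n
  Counts-transfer φ ψ φ-cong φ∘ψ ψ∘φ C = record
    { to      = C.to ∘ φ
    ; from    = ψ ∘ C.from
    ; to-cong = C.to-cong ∘ φ-cong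
    ; to-from = λ i → trans (C.to-cong (φ∘ψ (C.from i))) (C.to-from i)
    ; from-to = λ x → ψ∘φ (C.from-to (φ x))
    }
    where module C = Counts C

  Counts-Fin : Counts {A = Fin n} _≡_ n
  Counts-Fin = record
    { to = λ i → i ; from = λ i → i ; to-cong = λ e → e ; to-from = λ _ → refl ; from-to = λ _ → refl }

  Counts-⊤ : Counts {A = ⊤ {a}} _≡_ 1
  Counts-⊤ = record
    { to = λ _ → zero ; from = λ _ → _ ; to-cong = λ _ → refl ; to-from = λ { zero → refl } ; from-to = λ _ → refl }

  Counts-× : {_~_ : Rel A r} {_≈_ : Rel B s} → Counts _~_ m → Counts _≈_ n → Counts (Pointwise _~_ _≈_) (m * n)
  Counts-× {m = m} {n = n} {_~_ = _~_} {_≈_ = _≈_} C D = record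
    { to      = λ (x , y) → combine (C.to x) (D.to y)
    ; from    = λ k → let (i , j) = remQuot n k in C.from i , D.from j
    ; to-cong = λ (e , e') → cong₂ combine (C.to-cong e) (D.to-cong e')
    ; to-from = λ k → trans (cong₂ combine (C.to-from _) (D.to-from _)) (Fin.combine-remQuot {m} n k)
    ; from-to = λ (x , y) → let e = Fin.remQuot-combine {m} {n} (C.to x) (D.to y) in
        subst (λ (i , j) → Pointwise _~_ _≈_ (C.from i , D.from j) (x , y)) (sym e) (C.from-to x , D.from-to y)
    }
    where
    module C = Counts C
    module D = Counts D

  Counts-punchOut : {_~_ : Rel A r} → IsEquivalence _~_ → Counts _~_ (suc n) → (x₀ : A) →
                    Counts {A = Σ A λ x → ¬ x ~ x₀} (_~_ on proj₁) n
  Counts-punchOut {_~_ = _~_} ~-equiv C x₀ = record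
    { to      = λ (x , x≁x₀) → punchOut (to-distinct x≁x₀)
    ; from    = λ i → C.from (punchIn (C.to x₀) i) , from-distinct i
    ; to-cong = λ e → Fin.punchOut-cong (C.to x₀) (C.to-cong e)
    ; to-from = λ i → trans (Fin.punchOut-cong (C.to x₀) (C.to-from _)) (Fin.punchOut-punchIn (C.to x₀))
    ; from-to = λ (x , x≁x₀) → subst (λ j → C.from j ~ x) (sym (Fin.punchIn-punchOut (to-distinct x≁x₀))) (C.from-to x)
    }
    where
    module C = Counts C
    to-distinct : ∀ {x} → ¬ x ~ x₀ → C.to x₀ ≢ C.to x
    to-distinct x≁x₀ = x≁x₀ ∘ Counts-to-injective C ~-equiv ∘ sym
    from-distinct : ∀ i → ¬ C.from (punchIn (C.to x₀) i) ~ x₀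
    from-distinct i e = Fin.punchInᵢ≢i (C.to x₀) i (trans (sym (C.to-from _)) (C.to-cong e))

  Counts-≡× : Counts {A = A} _≡_ m → Counts {A = B} _≡_ n → Counts {A = A × B} _≡_ (m * n)
  Counts-≡× C D = Counts-transfer (λ u → u) (λ u → u) ≡⇒≡×≡ (λ _ → refl , refl) ≡×≡⇒≡ (Counts-× C D)

  Unordered : Rel A r → Rel (A × A) r
  Unordered _~_ (x , y) (x' , y') = (x ~ x' × y ~ y') ⊎ (x ~ y' × y ~ x')

  -- The pairs i < j of Fin (suc m) are numbered with the m pairs (0 , suc j) first,
  -- followed by the pairs (suc i , suc j).
  choose2 : ℕ → ℕ
  choose2 zero    = 0
  choose2 (suc m) = m + choose2 m

  pairIndex : (i j : Fin m) → .(i < j) → Fin (choose2 m)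
  pairIndex {suc m} zero    zero    i<j = ⊥-elim (ℕ.<-irrefl refl i<j)
  pairIndex {suc m} zero    (suc j) _   = j ↑ˡ choose2 m
  pairIndex {suc m} (suc i) zero    ()
  pairIndex {suc m} (suc i) (suc j) i<j = m ↑ʳ pairIndex i j (ℕ.≤-pred i<j)

  pairAt : Fin (choose2 m) → Fin m × Fin m
  pairAt {suc m} k with splitAt m k
  ... | inj₁ j = zero , suc j
  ... | inj₂ k = map suc suc (pairAt k)

  pairAt-< : (k : Fin (choose2 m)) → uncurry _<_ (pairAt {m} k)
  pairAt-< {suc m} k with splitAt m k
  ... | inj₁ j = s≤s z≤n
  ... | inj₂ k = s≤s (pairAt-< {m} k)

  pairAt-≢ : (k : Fin (choose2 m)) → uncurry _≢_ (pairAt {m} k)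
  pairAt-≢ {m} k e = Fin.<-irrefl e (pairAt-< {m} k)

  pairIndex-pairAt : (k : Fin (choose2 m)) .(i<j : uncurry _<_ (pairAt {m} k)) → uncurry pairIndex (pairAt {m} k) i<j ≡ k
  pairIndex-pairAt {suc m} k i<j with splitAt m k in eq
  ... | inj₁ j = Fin.splitAt⁻¹-↑ˡ eq
  ... | inj₂ k = trans (cong (m ↑ʳ_) (pairIndex-pairAt {m} k _)) (Fin.splitAt⁻¹-↑ʳ eq)

  pairAt-pairIndex : (i j : Fin m) .(i<j : i < j) → pairAt (pairIndex i j i<j) ≡ (i , j)
  pairAt-pairIndex {suc m} zero    zero    i<j = ⊥-elim (ℕ.<-irrefl refl i<j)
  pairAt-pairIndex {suc m} zero    (suc j) _   rewrite Fin.splitAt-↑ˡ m j (choose2 m) = refl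
  pairAt-pairIndex {suc m} (suc i) zero    ()
  pairAt-pairIndex {suc m} (suc i) (suc j) i<j rewrite Fin.splitAt-↑ʳ m (choose2 m) (pairIndex i j (ℕ.≤-pred i<j))
    | pairAt-pairIndex i j (ℕ.≤-pred i<j) = refl

  module _ {X : Set a} where

    sortPair : (i j : Fin m) (x y : X) → .(i ≢ j) → Fin (choose2 m) × X × X
    sortPair i j x y i≢j with <-cmp i j
    ... | tri< i<j _ _ = pairIndex i j i<j , x , y
    ... | tri≈ _ i≡j _ = ⊥-elim (i≢j i≡j)
    ... | tri> _ _ j<i = pairIndex j i j<i , y , x

    sortPair-cong : ∀ {i i' j j' : Fin m} {x x' y y' : X} .(i≢j : i ≢ j) .(i'≢j' : i' ≢ j') →
                    i ≡ i' → j ≡ j' → x ≡ x' → y ≡ y' → sortPair i j x y i≢j ≡ sortPair i' j' x' y' i'≢j'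
    sortPair-cong _ _ refl refl refl refl = refl

    sortPair-swap : (i j : Fin m) (x y : X) .(i≢j : i ≢ j) .(j≢i : j ≢ i) → sortPair i j x y i≢j ≡ sortPair j i y x j≢i
    sortPair-swap i j x y i≢j j≢i with <-cmp i j | <-cmp j i
    ... | tri< i<j _ _ | tri< j<i _ _ = ⊥-elim (Fin.<-asym i<j j<i)
    ... | tri< _ _ _   | tri≈ _ j≡i _ = ⊥-elim (j≢i j≡i)
    ... | tri< _ _ _   | tri> _ _ _   = refl
    ... | tri≈ _ i≡j _ | _            = ⊥-elim (i≢j i≡j)
    ... | tri> _ _ _   | tri< _ _ _   = refl
    ... | tri> _ _ _   | tri≈ _ j≡i _ = ⊥-elim (j≢i j≡i)
    ... | tri> _ _ j<i | tri> _ _ i<j = ⊥-elim (Fin.<-asym i<j j<i)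

    sortPair-pairAt : (k : Fin (choose2 m)) (x y : X) .(i≢j : uncurry _≢_ (pairAt {m} k)) →
                      sortPair (proj₁ (pairAt {m} k)) (proj₂ (pairAt {m} k)) x y i≢j ≡ (k , x , y)
    sortPair-pairAt {m} k x y i≢j with <-cmp (proj₁ (pairAt {m} k)) (proj₂ (pairAt {m} k))
    ... | tri< i<j _ _ = cong (_, x , y) (pairIndex-pairAt {m} k i<j)
    ... | tri≈ _ i≡j _ = ⊥-elim (i≢j i≡j)
    ... | tri> _ _ j<i = ⊥-elim (Fin.<-asym j<i (pairAt-< {m} k))

    pairAt-sortPair : (i j : Fin m) (x y : X) .(i≢j : i ≢ j) → let (k , xy) = sortPair i j x y i≢j in
                      (pairAt {m} k ≡ (i , j) × xy ≡ (x , y)) ⊎ (pairAt {m} k ≡ (j , i) × xy ≡ (y , x))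
    pairAt-sortPair i j x y i≢j with <-cmp i j
    ... | tri< i<j _ _ = inj₁ (pairAt-pairIndex i j i<j , refl)
    ... | tri≈ _ i≡j _ = ⊥-elim (i≢j i≡j)
    ... | tri> _ _ j<i = inj₂ (pairAt-pairIndex j i j<i , refl)

  DistinctKeyPairs : Rel A r → Set b → Set _
  DistinctKeyPairs {A = A} _~_ X = Σ ((A × X) × (A × X)) λ ((p , _) , (p' , _)) → ¬ p ~ p'

  Counts-distinctKeyPairs : ∀ {a b r s} {A : Set a} {X : Set b} {m n} {_~_ : Rel A r} {_≈_ : Rel X s} →
                            IsEquivalence _~_ → Counts _~_ m → Counts _≈_ n →
                            Counts {A = DistinctKeyPairs _~_ X} (Unordered (Pointwise _~_ _≈_) on proj₁)
                                   (choose2 m * (n * n))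
  Counts-distinctKeyPairs {X = X} {m = m} {n = n} {_~_ = _~_} {_≈_ = _≈_} ~-equiv C D =
    Counts-transfer code decode (λ {T} {T'} → code-cong {T} {T'}) code-decode (λ {T} → decode-code {T})
                    (Counts-≡× Counts-Fin (Counts-≡× Counts-Fin Counts-Fin))
    where
    module C = Counts C
    module D = Counts D
    open IsEquivalence ~-equiv renaming (sym to ~-sym; trans to ~-trans)

    C-from-to : ∀ {i p} → i ≡ C.to p → C.from i ~ p
    C-from-to refl = C.from-to _

    D-from-to : ∀ {i x} → i ≡ D.to x → D.from i ≈ x
    D-from-to refl = D.from-to _

    to-distinct : ∀ {p p'} → ¬ p ~ p' → C.to p ≢ C.to p'
    to-distinct p≁p' = p≁p' ∘ Counts-to-injective C ~-equiv

    code : DistinctKeyPairs _~_ X → Fin (choose2 m) × Fin n × Fin n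
    code (((p , x) , (p' , y)) , p≁p') = sortPair (C.to p) (C.to p') (D.to x) (D.to y) (to-distinct p≁p')

    from-distinct : (k : Fin (choose2 m)) → ¬ C.from (proj₁ (pairAt k)) ~ C.from (proj₂ (pairAt k))
    from-distinct k = pairAt-≢ {m} k ∘ Counts-from-injective C

    decode : Fin (choose2 m) × Fin n × Fin n → DistinctKeyPairs _~_ X
    decode (k , i , j) = ((C.from (proj₁ (pairAt k)) , D.from i) , (C.from (proj₂ (pairAt k)) , D.from j)) , from-distinct k

    code-cong : ∀ {T T'} → Unordered (Pointwise _~_ _≈_) (proj₁ T) (proj₁ T') → code T ≡ code T'
    code-cong {T = _ , p≁p'} {T' = _ , q≁q'} (inj₁ ((p~q , x≈u) , (p'~q' , y≈v))) =
      sortPair-cong (to-distinct p≁p') (to-distinct q≁q')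
                    (C.to-cong p~q) (C.to-cong p'~q') (D.to-cong x≈u) (D.to-cong y≈v)
    code-cong {T = _ , p≁p'} {T' = ((q , u) , (q' , v)) , q≁q'} (inj₂ ((p~q' , x≈v) , (p'~q , y≈u))) =
      trans (sortPair-cong (to-distinct p≁p') (to-distinct (q≁q' ∘ ~-sym))
                           (C.to-cong p~q') (C.to-cong p'~q) (D.to-cong x≈v) (D.to-cong y≈u))
            (sortPair-swap (C.to q') (C.to q) (D.to v) (D.to u) _ (to-distinct q≁q'))

    code-decode : ∀ u → code (decode u) ≡ u
    code-decode (k , i , j) = trans (sortPair-cong (to-distinct (from-distinct k)) (pairAt-≢ {m} k)
                                                  (C.to-from _) (C.to-from _) (D.to-from i) (D.to-from j))
                                    (sortPair-pairAt {m = m} k i j _)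

    decode-code : ∀ {T u} → u ≡ code T → Unordered (Pointwise _~_ _≈_) (proj₁ (decode u)) (proj₁ T)
    decode-code {T = ((p , x) , (p' , y)) , _} refl with pairAt-sortPair (C.to p) (C.to p') (D.to x) (D.to y) _
    ... | inj₁ (e , e') = inj₁ ((C-from-to (cong proj₁ e) , D-from-to (cong proj₁ e')) ,
                                (C-from-to (cong proj₂ e) , D-from-to (cong proj₂ e')))
    ... | inj₂ (e , e') = inj₂ ((C-from-to (cong proj₁ e) , D-from-to (cong proj₁ e')) ,
                                (C-from-to (cong proj₂ e) , D-from-to (cong proj₂ e')))

open Counting

module FiniteFieldProperties {c ℓ f} (F : FiniteField c ℓ (suc f)) where
  open FiniteField F public hiding (zero)
  open IntegerCoefficientSolver commRing public using (solve; _:+_; _:*_; _:-_; :-_; _:=_; :0; :1)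
  open import Relation.Binary.Reasoning.Setoid setoid public
  open import Algebra.Properties.Ring ring public using (-0#≈0#; -‿injective; x∙y⁻¹≈ε⇒x≈y; x≈y⇒x∙y⁻¹≈ε)
  private
    module finite = Counts finite

  infix 4 _≟_
  _≟_ : Decidable _≈_
  x ≟ y with finite.to x Fin.≟ finite.to y
  ... | yes e = yes (Counts-to-injective finite isEquivalence e)
  ... | no ne = no (ne ∘ finite.to-cong)

  1≉0 : ¬ 1# ≈ 0#
  1≉0 = 0≉1 ∘ sym

  -x≈0⇒x≈0 : ∀ {x} → - x ≈ 0# → x ≈ 0#
  -x≈0⇒x≈0 e = -‿injective (trans e (sym -0#≈0#))

  -- 0⁻¹ is the junk value 0.
  _⁻¹ : Carrier → Carrier
  x ⁻¹ with x ≟ 0#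
  ... | yes _  = 0#
  ... | no x≉0 = proj₁ (inverse x x≉0)

  ⁻¹-inverseʳ : ∀ {x} → ¬ x ≈ 0# → x * x ⁻¹ ≈ 1#
  ⁻¹-inverseʳ {x} x≉0 with x ≟ 0#
  ... | yes x≈0  = ⊥-elim (x≉0 x≈0)
  ... | no x≉0′  = proj₂ (inverse x x≉0′)

  ⁻¹-inverseˡ : ∀ {x} → ¬ x ≈ 0# → x ⁻¹ * x ≈ 1#
  ⁻¹-inverseˡ x≉0 = trans (*-comm _ _) (⁻¹-inverseʳ x≉0)

  ⁻¹-cong : ∀ {x y} → x ≈ y → x ⁻¹ ≈ y ⁻¹
  ⁻¹-cong {x} {y} x≈y with x ≟ 0# | y ≟ 0#
  ... | yes _   | yes _   = refl
  ... | yes x≈0 | no y≉0  = ⊥-elim (y≉0 (trans (sym x≈y) x≈0))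
  ... | no x≉0  | yes y≈0 = ⊥-elim (x≉0 (trans x≈y y≈0))
  ... | no x≉0  | no y≉0  = begin
    x′               ≈⟨ sym (*-identityʳ x′) ⟩
    x′ * 1#          ≈⟨ *-congˡ (sym (proj₂ (inverse y y≉0))) ⟩
    x′ * (y * y′)    ≈⟨ sym (*-assoc _ _ _) ⟩
    (x′ * y) * y′    ≈⟨ *-congʳ (*-congˡ (sym x≈y)) ⟩
    (x′ * x) * y′    ≈⟨ *-congʳ (trans (*-comm _ _) (proj₂ (inverse x x≉0))) ⟩
    1# * y′          ≈⟨ *-identityˡ y′ ⟩
    y′               ∎
    where
    x′ = proj₁ (inverse x x≉0)
    y′ = proj₁ (inverse y y≉0)

  x*y≈0⇒y≈0 : ∀ {x y} → x * y ≈ 0# → ¬ x ≈ 0# → y ≈ 0#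
  x*y≈0⇒y≈0 {x} {y} xy≈0 x≉0 = begin
    y                ≈⟨ sym (*-identityˡ y) ⟩
    1# * y           ≈⟨ *-congʳ (sym (⁻¹-inverseˡ x≉0)) ⟩
    (x ⁻¹ * x) * y   ≈⟨ *-assoc _ _ _ ⟩
    x ⁻¹ * (x * y)   ≈⟨ *-congˡ xy≈0 ⟩
    x ⁻¹ * 0#        ≈⟨ zeroʳ _ ⟩
    0#               ∎

  *-nonzero : ∀ {x y} → ¬ x ≈ 0# → ¬ y ≈ 0# → ¬ x * y ≈ 0#
  *-nonzero x≉0 y≉0 xy≈0 = y≉0 (x*y≈0⇒y≈0 xy≈0 x≉0)

  Nonzero : Set _
  Nonzero = Σ Carrier λ x → ¬ x ≈ 0#

  Counts-Nonzero : Counts (_≈_ on proj₁) f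
  Counts-Nonzero = Counts-punchOut isEquivalence finite 0#

  Coord : ℕ → Set c
  Coord = VectorSpace.V F

  module _ {k : ℕ} where
    open VectorSpace F k public using ()
      renaming (_≈ⱽ_ to _≈ᶜ_; 0ⱽ to 0ᶜ; _+ⱽ_ to _+ᶜ_; _-ⱽ_ to _-ᶜ_; _·_ to _·ᶜ_)

  Spanning : ∀ {k} → Coord k → Coord k → Set _
  Spanning x y = ∀ z → Σ Carrier λ α → Σ Carrier λ β → z ≈ᶜ ((α ·ᶜ x) +ᶜ (β ·ᶜ y))

  DistinctNonzeroPairs : Set _
  DistinctNonzeroPairs = Σ (Coord 1 × Coord 1) λ (a , b) → ¬ a ≈ᶜ 0ᶜ × ¬ b ≈ᶜ 0ᶜ × ¬ a ≈ᶜ b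

  Counts-distinctNonzeroPairs : Counts {A = DistinctNonzeroPairs} (Unordered _≈ᶜ_ on proj₁) (choose2 f)
  Counts-distinctNonzeroPairs = ≡.subst (Counts _) (ℕ.*-identityʳ (choose2 f)) (Counts-transfer φ ψ
    (λ {x} {y} → φ-cong {x} {y}) φ∘ψ (λ {x} {u} → ψ∘φ {x} {u})
    (Counts-distinctKeyPairs (On.isEquivalence proj₁ isEquivalence) Counts-Nonzero (Counts-⊤ {c})))
    where
    _~_ : Rel (Nonzero × ⊤) _
    _~_ = Pointwise (_≈_ on proj₁) _≡_

    ≈ᶜ-single : ∀ {a b : Coord 1} → a zero ≈ b zero → a ≈ᶜ b
    ≈ᶜ-single e zero = e

    φ : DistinctNonzeroPairs → DistinctKeyPairs (_≈_ on proj₁) ⊤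
    φ ((a , b) , a≉0 , b≉0 , a≉b) =
      (((a zero , a≉0 ∘ ≈ᶜ-single) , _) , ((b zero , b≉0 ∘ ≈ᶜ-single) , _)) , a≉b ∘ ≈ᶜ-single

    ψ : DistinctKeyPairs (_≈_ on proj₁) ⊤ → DistinctNonzeroPairs
    ψ ((((x , x≉0) , _) , ((y , y≉0) , _)) , x≉y) =
      ((λ _ → x) , (λ _ → y)) , x≉0 ∘ (_$ zero) , y≉0 ∘ (_$ zero) , x≉y ∘ (_$ zero)

    φ-cong : ∀ {x y} → Unordered _≈ᶜ_ (proj₁ x) (proj₁ y) → Unordered _~_ (proj₁ (φ x)) (proj₁ (φ y))
    φ-cong (inj₁ (a≈a' , b≈b')) = inj₁ ((a≈a' zero , ≡.refl) , (b≈b' zero , ≡.refl))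
    φ-cong (inj₂ (a≈b' , b≈a')) = inj₂ ((a≈b' zero , ≡.refl) , (b≈a' zero , ≡.refl))

    φ∘ψ : ∀ u → Unordered _~_ (proj₁ (φ (ψ u))) (proj₁ u)
    φ∘ψ _ = inj₁ ((refl , ≡.refl) , (refl , ≡.refl))

    ψ∘φ : ∀ {x u} → Unordered _~_ (proj₁ u) (proj₁ (φ x)) → Unordered _≈ᶜ_ (proj₁ (ψ u)) (proj₁ x)
    ψ∘φ (inj₁ ((x≈ , _) , (y≈ , _))) = inj₁ (≈ᶜ-single x≈ , ≈ᶜ-single y≈)
    ψ∘φ (inj₂ ((x≈ , _) , (y≈ , _))) = inj₂ (≈ᶜ-single x≈ , ≈ᶜ-single y≈)

module Plane {c ℓ f} (F : FiniteField c ℓ (suc f)) where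
  open FiniteFieldProperties F
  private
    module finite = Counts finite

  det : Coord 2 → Coord 2 → Carrier
  det a b = a zero * b (suc zero) - a (suc zero) * b zero

  det-cong : ∀ {a a' b b'} → a ≈ᶜ a' → b ≈ᶜ b' → det a b ≈ det a' b'
  det-cong a≈a' b≈b' =
    +-cong (*-cong (a≈a' zero) (b≈b' (suc zero))) (-‿cong (*-cong (a≈a' (suc zero)) (b≈b' zero)))

  det-self : ∀ a → det a a ≈ 0#
  det-self a = solve 2 (λ x y → x :* y :- y :* x := :0) refl (a zero) (a (suc zero))

  det-zeroˡ : ∀ {a} b → a ≈ᶜ 0ᶜ → det a b ≈ 0#
  det-zeroˡ {a} b a≈0 = begin
    det a b     ≈⟨ det-cong {b = b} a≈0 (λ _ → refl) ⟩
    det 0ᶜ b    ≈⟨ solve 2 (λ x y → :0 :* y :- :0 :* x := :0) refl (b zero) (b (suc zero)) ⟩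
    0#          ∎

  det-zeroʳ : ∀ a {b} → b ≈ᶜ 0ᶜ → det a b ≈ 0#
  det-zeroʳ a {b} b≈0 = begin
    det a b     ≈⟨ det-cong {a = a} (λ _ → refl) b≈0 ⟩
    det a 0ᶜ    ≈⟨ solve 2 (λ x y → x :* :0 :- y :* :0 := :0) refl (a zero) (a (suc zero)) ⟩
    0#          ∎

  det-· : ∀ s s' a b → det (s ·ᶜ a) (s' ·ᶜ b) ≈ (s * s') * det a b
  det-· s s' a b =
    solve 6 (λ s s' a₀ a₁ b₀ b₁ → (s :* a₀) :* (s' :* b₁) :- (s :* a₁) :* (s' :* b₀)
                                  := (s :* s') :* (a₀ :* b₁ :- a₁ :* b₀))
            refl s s' (a zero) (a (suc zero)) (b zero) (b (suc zero))

  -- Cramer's rule.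
  det-spanning : ∀ {a b} → ¬ det a b ≈ 0# → Spanning a b
  det-spanning {a} {b} D≉0 x = α , β , component
    where
    a₀ = a zero
    a₁ = a (suc zero)
    b₀ = b zero
    b₁ = b (suc zero)
    x₀ = x zero
    x₁ = x (suc zero)
    I = det a b ⁻¹
    α = (x₀ * b₁ - x₁ * b₀) * I
    β = (a₀ * x₁ - a₁ * x₀) * I
    ≈*DI : ∀ y → y ≈ y * (det a b * I)
    ≈*DI y = sym (trans (*-congˡ (⁻¹-inverseʳ D≉0)) (*-identityʳ y))
    component : ∀ i → x i ≈ α * a i + β * b i
    component zero = trans (≈*DI x₀)
      (solve 7 (λ x₀ x₁ a₀ a₁ b₀ b₁ I → x₀ :* ((a₀ :* b₁ :- a₁ :* b₀) :* I)
                  := ((x₀ :* b₁ :- x₁ :* b₀) :* I) :* a₀ :+ ((a₀ :* x₁ :- a₁ :* x₀) :* I) :* b₀)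
               refl x₀ x₁ a₀ a₁ b₀ b₁ I)
    component (suc zero) = trans (≈*DI x₁)
      (solve 7 (λ x₀ x₁ a₀ a₁ b₀ b₁ I → x₁ :* ((a₀ :* b₁ :- a₁ :* b₀) :* I)
                  := ((x₀ :* b₁ :- x₁ :* b₀) :* I) :* a₁ :+ ((a₀ :* x₁ :- a₁ :* x₀) :* I) :* b₁)
               refl x₀ x₁ a₀ a₁ b₀ b₁ I)

  ℙ¹ : Set
  ℙ¹ = Fin (suc (suc f))

  -- zero is the line through (0 , 1), and suc r the line through (1 , r) for the r-th field element.
  point : ℙ¹ → Coord 2
  point zero    = 0# ∷ 1# ∷ []
  point (suc r) = 1# ∷ finite.from r ∷ []

  line : Coord 2 → ℙ¹
  line a with a zero ≟ 0#
  ... | yes _ = zero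
  ... | no _  = suc (finite.to (a (suc zero) * a zero ⁻¹))

  scale : Coord 2 → Carrier
  scale a with a zero ≟ 0#
  ... | yes _ = a (suc zero)
  ... | no _  = a zero

  scale·point-line : ∀ a → (scale a ·ᶜ point (line a)) ≈ᶜ a
  scale·point-line a with a zero ≟ 0#
  ... | yes a₀≈0 = λ { zero → trans (zeroʳ _) (sym a₀≈0) ; (suc zero) → *-identityʳ _ }
  ... | no a₀≉0  = λ { zero → *-identityʳ _ ; (suc zero) → begin
    a₀ * finite.from (finite.to (a₁ * a₀ ⁻¹))  ≈⟨ *-congˡ (finite.from-to _) ⟩
    a₀ * (a₁ * a₀ ⁻¹)
      ≈⟨ solve 3 (λ a₀ a₁ i → a₀ :* (a₁ :* i) := a₁ :* (a₀ :* i)) refl a₀ a₁ (a₀ ⁻¹) ⟩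
    a₁ * (a₀ * a₀ ⁻¹)                          ≈⟨ *-congˡ (⁻¹-inverseʳ a₀≉0) ⟩
    a₁ * 1#                                    ≈⟨ *-identityʳ a₁ ⟩
    a₁                                         ∎ }
    where
    a₀ = a zero
    a₁ = a (suc zero)

  scale-nonzero : ∀ {a} → ¬ a ≈ᶜ 0ᶜ → ¬ scale a ≈ 0#
  scale-nonzero {a} a≉0 s≈0 = a≉0 λ i → trans (sym (scale·point-line a i)) (trans (*-congʳ s≈0) (zeroˡ _))

  line-cong : ∀ {a b} → a ≈ᶜ b → line a ≡ line b
  line-cong {a} {b} a≈b with a zero ≟ 0# | b zero ≟ 0#
  ... | yes _   | yes _   = ≡.refl
  ... | yes a₀≈0 | no b₀≉0 = ⊥-elim (b₀≉0 (trans (sym (a≈b zero)) a₀≈0))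
  ... | no a₀≉0 | yes b₀≈0 = ⊥-elim (a₀≉0 (trans (a≈b zero) b₀≈0))
  ... | no _    | no _    = ≡.cong suc (finite.to-cong (*-cong (a≈b (suc zero)) (⁻¹-cong (a≈b zero))))

  scale-cong : ∀ {a b} → a ≈ᶜ b → scale a ≈ scale b
  scale-cong {a} {b} a≈b with a zero ≟ 0# | b zero ≟ 0#
  ... | yes _   | yes _   = a≈b (suc zero)
  ... | yes a₀≈0 | no b₀≉0 = ⊥-elim (b₀≉0 (trans (sym (a≈b zero)) a₀≈0))
  ... | no a₀≉0 | yes b₀≈0 = ⊥-elim (a₀≉0 (trans (a≈b zero) b₀≈0))
  ... | no _    | no _    = a≈b zero

  line-scale·point : ∀ {s} → ¬ s ≈ 0# → ∀ p → line (s ·ᶜ point p) ≡ p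
  line-scale·point {s} s≉0 zero with s * 0# ≟ 0#
  ... | yes _     = ≡.refl
  ... | no s0≉0   = ⊥-elim (s0≉0 (zeroʳ s))
  line-scale·point {s} s≉0 (suc r) with s * 1# ≟ 0#
  ... | yes s1≈0  = ⊥-elim (s≉0 (trans (sym (*-identityʳ s)) s1≈0))
  ... | no s1≉0   = ≡.cong suc (≡.trans (finite.to-cong r≈) (finite.to-from r))
    where
    x = finite.from r
    r≈ : (s * x) * (s * 1#) ⁻¹ ≈ x
    r≈ = begin
      (s * x) * (s * 1#) ⁻¹           ≈⟨ solve 3 (λ s x i → (s :* x) :* i := x :* (s :* :1 :* i)) refl s x _ ⟩
      x * ((s * 1#) * (s * 1#) ⁻¹)    ≈⟨ *-congˡ (⁻¹-inverseʳ s1≉0) ⟩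
      x * 1#                          ≈⟨ *-identityʳ x ⟩
      x                               ∎

  scale-scale·point : ∀ {s} → ¬ s ≈ 0# → ∀ p → scale (s ·ᶜ point p) ≈ s
  scale-scale·point {s} s≉0 zero with s * 0# ≟ 0#
  ... | yes _     = *-identityʳ s
  ... | no s0≉0   = ⊥-elim (s0≉0 (zeroʳ s))
  scale-scale·point {s} s≉0 (suc r) with s * 1# ≟ 0#
  ... | yes s1≈0  = ⊥-elim (s≉0 (trans (sym (*-identityʳ s)) s1≈0))
  ... | no _      = *-identityʳ s

  det-point : ∀ {p p'} → p ≢ p' → ¬ det (point p) (point p') ≈ 0#
  det-point {zero}  {zero}   p≢p' _ = p≢p' ≡.refl
  det-point {zero}  {suc r'} _ D≈0 =
    1≉0 (-x≈0⇒x≈0 (trans (solve 1 (λ x → :- :1 := :0 :* x :- :1 :* :1) refl (finite.from r')) D≈0))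
  det-point {suc r} {zero}   _ D≈0 =
    1≉0 (trans (solve 1 (λ x → :1 := :1 :* :1 :- x :* :0) refl (finite.from r)) D≈0)
  det-point {suc r} {suc r'} p≢p' D≈0 = p≢p' (≡.cong suc (Counts-from-injective finite (sym x'≈x)))
    where
    x = finite.from r
    x' = finite.from r'
    x'≈x : x' ≈ x
    x'≈x = x∙y⁻¹≈ε⇒x≈y x' x (trans (solve 2 (λ x x' → x' :- x := :1 :* x' :- x :* :1) refl x x') D≈0)

  det≉0⇒nonzeroˡ : ∀ {a b} → ¬ det a b ≈ 0# → ¬ a ≈ᶜ 0ᶜ
  det≉0⇒nonzeroˡ {b = b} D≉0 a≈0 = D≉0 (det-zeroˡ b a≈0)

  det≉0⇒nonzeroʳ : ∀ {a b} → ¬ det a b ≈ 0# → ¬ b ≈ᶜ 0ᶜ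
  det≉0⇒nonzeroʳ {a} D≉0 b≈0 = D≉0 (det-zeroʳ a b≈0)

  det-via-lines : ∀ a b → det a b ≈ (scale a * scale b) * det (point (line a)) (point (line b))
  det-via-lines a b = begin
    det a b                                                      ≈⟨ sym (det-cong (scale·point-line a) (scale·point-line b)) ⟩
    det (scale a ·ᶜ point (line a)) (scale b ·ᶜ point (line b))  ≈⟨ det-· (scale a) (scale b) (point (line a)) (point (line b)) ⟩
    (scale a * scale b) * det (point (line a)) (point (line b))  ∎

  det≉0⇒line≢ : ∀ {a b} → ¬ det a b ≈ 0# → line a ≢ line b
  det≉0⇒line≢ {a} {b} D≉0 la≡lb = D≉0 (begin
    det a b                                          ≈⟨ det-via-lines a b ⟩
    (scale a * scale b) * det pa (point (line b))    ≡⟨ ≡.cong (λ p → (scale a * scale b) * det pa (point p)) (≡.sym la≡lb) ⟩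
    (scale a * scale b) * det pa pa                  ≈⟨ *-congˡ (det-self pa) ⟩
    (scale a * scale b) * 0#                         ≈⟨ zeroʳ _ ⟩
    0#                                               ∎)
    where pa = point (line a)

  det≈0⇒proportional : ∀ {a b} → ¬ a ≈ᶜ 0ᶜ → ¬ b ≈ᶜ 0ᶜ → det a b ≈ 0# →
                       Σ Carrier λ λ' → b ≈ᶜ (λ' ·ᶜ a)
  det≈0⇒proportional {a} {b} a≉0 b≉0 D≈0 with line a Fin.≟ line b
  ... | no la≢lb = ⊥-elim (*-nonzero (*-nonzero sa≉0 (scale-nonzero b≉0)) (det-point la≢lb)
                                      (trans (sym (det-via-lines a b)) D≈0))
    where sa≉0 = scale-nonzero a≉0
  ... | yes la≡lb = sb * sa ⁻¹ , λ i → begin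
    b i                                ≈⟨ sym (scale·point-line b i) ⟩
    sb * point (line b) i              ≡⟨ ≡.cong (λ p → sb * point p i) (≡.sym la≡lb) ⟩
    sb * pa i
      ≈⟨ *-congˡ (sym (trans (*-congʳ (⁻¹-inverseˡ (scale-nonzero a≉0))) (*-identityˡ _))) ⟩
    sb * ((sa ⁻¹ * sa) * pa i)
      ≈⟨ solve 4 (λ t i s x → t :* ((i :* s) :* x) := (t :* i) :* (s :* x)) refl sb (sa ⁻¹) sa _ ⟩
    (sb * sa ⁻¹) * (sa * pa i)         ≈⟨ *-congˡ (scale·point-line a i) ⟩
    (sb * sa ⁻¹) * a i                 ∎
    where
    sa = scale a
    sb = scale b
    pa = point (line a)

  IndependentPairs : Set _
  IndependentPairs = Σ (Coord 2 × Coord 2) λ (a , b) → ¬ det a b ≈ 0#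

  -- An independent pair is an unordered pair of distinct lines, each carrying a nonzero scale.
  Counts-independentPairs : Counts {A = IndependentPairs} (Unordered _≈ᶜ_ on proj₁)
                                   (choose2 (suc (suc f)) ℕ.* (f ℕ.* f))
  Counts-independentPairs =
    Counts-transfer φ ψ (λ {x} {y} → φ-cong {x} {y}) φ∘ψ (λ {x} {u} → ψ∘φ {x} {u})
                    (Counts-distinctKeyPairs ≡.isEquivalence Counts-Fin Counts-Nonzero)
    where
    _~_ : Rel (ℙ¹ × Nonzero) _
    _~_ = Pointwise _≡_ (_≈_ on proj₁)

    φ : IndependentPairs → DistinctKeyPairs _≡_ Nonzero
    φ ((a , b) , D≉0) = ((line a , scale a , scale-nonzero (det≉0⇒nonzeroˡ {b = b} D≉0)) ,
                         (line b , scale b , scale-nonzero (det≉0⇒nonzeroʳ {a} D≉0))) , det≉0⇒line≢ D≉0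

    ψ : DistinctKeyPairs _≡_ Nonzero → IndependentPairs
    ψ (((p , s , s≉0) , (p' , s' , s'≉0)) , p≢p') = (s ·ᶜ point p , s' ·ᶜ point p') , λ D≈0 →
      *-nonzero (*-nonzero s≉0 s'≉0) (det-point p≢p') (trans (sym (det-· s s' (point p) (point p'))) D≈0)

    line-scale-cong : ∀ {a b} → a ≈ᶜ b → line a ≡ line b × scale a ≈ scale b
    line-scale-cong a≈b = line-cong a≈b , scale-cong a≈b

    φ-cong : ∀ {x y} → Unordered _≈ᶜ_ (proj₁ x) (proj₁ y) → Unordered _~_ (proj₁ (φ x)) (proj₁ (φ y))
    φ-cong (inj₁ (a≈a' , b≈b')) = inj₁ (line-scale-cong a≈a' , line-scale-cong b≈b')
    φ-cong (inj₂ (a≈b' , b≈a')) = inj₂ (line-scale-cong a≈b' , line-scale-cong b≈a')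

    φ∘ψ : ∀ u → Unordered _~_ (proj₁ (φ (ψ u))) (proj₁ u)
    φ∘ψ (((p , s , s≉0) , (p' , s' , s'≉0)) , _) =
      inj₁ ((line-scale·point s≉0 p , scale-scale·point s≉0 p) ,
            (line-scale·point s'≉0 p' , scale-scale·point s'≉0 p'))

    scale·point≈ : ∀ {p s a} → p ≡ line a → s ≈ scale a → (s ·ᶜ point p) ≈ᶜ a
    scale·point≈ ≡.refl s≈ i = trans (*-congʳ s≈) (scale·point-line _ i)

    ψ∘φ : ∀ {x u} → Unordered _~_ (proj₁ u) (proj₁ (φ x)) → Unordered _≈ᶜ_ (proj₁ (ψ u)) (proj₁ x)
    ψ∘φ (inj₁ ((p≡ , s≈) , (p'≡ , s'≈))) = inj₁ (scale·point≈ p≡ s≈ , scale·point≈ p'≡ s'≈)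
    ψ∘φ (inj₂ ((p≡ , s≈) , (p'≡ , s'≈))) = inj₂ (scale·point≈ p≡ s≈ , scale·point≈ p'≡ s'≈)

module LinearAlgebra {c ℓ f} (F : FiniteField c ℓ (suc f)) (n : ℕ) where
  open FiniteFieldProperties F
  open VectorSpace F n

  ≈ⱽ-refl : ∀ {x} → x ≈ⱽ x
  ≈ⱽ-refl _ = refl

  ≈ⱽ-sym : ∀ {x y} → x ≈ⱽ y → y ≈ⱽ x
  ≈ⱽ-sym x≈y i = sym (x≈y i)

  ≈ⱽ-trans : ∀ {x y z} → x ≈ⱽ y → y ≈ⱽ z → x ≈ⱽ z
  ≈ⱽ-trans x≈y y≈z i = trans (x≈y i) (y≈z i)

  lincomb-cong : ∀ {k} {a a' : Coord k} (B : Fin k → V) → a ≈ᶜ a' → lincomb a B ≈ⱽ lincomb a' B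
  lincomb-cong {zero}  B a≈a' = ≈ⱽ-refl
  lincomb-cong {suc k} B a≈a' i = +-cong (*-congʳ (a≈a' zero)) (lincomb-cong (B ∘ suc) (a≈a' ∘ suc) i)

  lincomb-0 : ∀ {k} (B : Fin k → V) → lincomb 0ᶜ B ≈ⱽ 0ⱽ
  lincomb-0 {zero}  B = ≈ⱽ-refl
  lincomb-0 {suc k} B i = trans (+-cong (zeroˡ _) (lincomb-0 (B ∘ suc) i)) (+-identityʳ 0#)

  lincomb-+ : ∀ {k} (a a' : Coord k) (B : Fin k → V) → lincomb (a +ᶜ a') B ≈ⱽ (lincomb a B +ⱽ lincomb a' B)
  lincomb-+ {zero}  a a' B i = sym (+-identityʳ 0#)
  lincomb-+ {suc k} a a' B i = trans (+-congˡ (lincomb-+ (a ∘ suc) (a' ∘ suc) (B ∘ suc) i))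
    (solve 5 (λ x x' b l l' → (x :+ x') :* b :+ (l :+ l') := (x :* b :+ l) :+ (x' :* b :+ l')) refl
       (a zero) (a' zero) (B zero i) (lincomb (a ∘ suc) (B ∘ suc) i) (lincomb (a' ∘ suc) (B ∘ suc) i))

  lincomb-· : ∀ {k} (α : Carrier) (a : Coord k) (B : Fin k → V) → lincomb (α ·ᶜ a) B ≈ⱽ (α · lincomb a B)
  lincomb-· {zero}  α a B i = sym (zeroʳ α)
  lincomb-· {suc k} α a B i = trans (+-congˡ (lincomb-· α (a ∘ suc) (B ∘ suc) i))
    (solve 4 (λ α x b l → (α :* x) :* b :+ α :* l := α :* (x :* b :+ l)) refl
       α (a zero) (B zero i) (lincomb (a ∘ suc) (B ∘ suc) i))

  lincomb-- : ∀ {k} (a a' : Coord k) (B : Fin k → V) → lincomb (a -ᶜ a') B ≈ⱽ (lincomb a B -ⱽ lincomb a' B)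
  lincomb-- {zero}  a a' B i = solve 0 (:0 := :0 :- :0) refl
  lincomb-- {suc k} a a' B i = trans (+-congˡ (lincomb-- (a ∘ suc) (a' ∘ suc) (B ∘ suc) i))
    (solve 5 (λ x x' b l l' → (x :- x') :* b :+ (l :- l') := (x :* b :+ l) :- (x' :* b :+ l')) refl
       (a zero) (a' zero) (B zero i) (lincomb (a ∘ suc) (B ∘ suc) i) (lincomb (a' ∘ suc) (B ∘ suc) i))

  lincomb-pair : ∀ (a : Coord 2) v w → lincomb a (pair v w) ≈ⱽ ((a zero · v) +ⱽ (a (suc zero) · w))
  lincomb-pair a v w i = +-congˡ (+-identityʳ _)

  lincomb-pair-lincomb : ∀ {k} (c : Coord 2) (x y : Coord k) (B : Fin k → V) →
                         lincomb c (pair (lincomb x B) (lincomb y B))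
                           ≈ⱽ lincomb ((c zero ·ᶜ x) +ᶜ (c (suc zero) ·ᶜ y)) B
  lincomb-pair-lincomb c x y B i = sym (begin
    lincomb ((c₀ ·ᶜ x) +ᶜ (c₁ ·ᶜ y)) B i                   ≈⟨ lincomb-+ (c₀ ·ᶜ x) (c₁ ·ᶜ y) B i ⟩
    lincomb (c₀ ·ᶜ x) B i + lincomb (c₁ ·ᶜ y) B i          ≈⟨ +-cong (lincomb-· c₀ x B i) (lincomb-· c₁ y B i) ⟩
    c₀ * lincomb x B i + c₁ * lincomb y B i                ≈⟨ sym (lincomb-pair c (lincomb x B) (lincomb y B) i) ⟩
    lincomb c (pair (lincomb x B) (lincomb y B)) i         ∎)
    where
    c₀ = c zero
    c₁ = c (suc zero)

  lincomb-injective : ∀ {k} {B : Fin k → V} → LinIndep B → ∀ {a a'} → lincomb a B ≈ⱽ lincomb a' B → a ≈ᶜ a'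
  lincomb-injective {B = B} B-indep {a} {a'} e i =
    x∙y⁻¹≈ε⇒x≈y _ _ (B-indep (a -ᶜ a') (≈ⱽ-trans (lincomb-- a a' B) (λ j → x≈y⇒x∙y⁻¹≈ε (e j))) i)

  lincomb-nonzero : ∀ {k} {B : Fin k → V} → LinIndep B → ∀ {a} → ¬ a ≈ᶜ 0ᶜ → ¬ lincomb a B ≈ⱽ 0ⱽ
  lincomb-nonzero {B = B} B-indep a≉0 e = a≉0 (lincomb-injective B-indep (≈ⱽ-trans e (≈ⱽ-sym (lincomb-0 B))))

  left∈span : ∀ v w → InSpan (pair v w) v
  left∈span v w = (λ { zero → 1# ; (suc _) → 0# }) , λ i →
    solve 2 (λ x y → x := :1 :* x :+ (:0 :* y :+ :0)) refl (v i) (w i)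

  right∈span : ∀ v w → InSpan (pair v w) w
  right∈span v w = (λ { zero → 0# ; (suc _) → 1# }) , λ i →
    solve 2 (λ x y → y := :0 :* x :+ (:1 :* y :+ :0)) refl (v i) (w i)

  span-swap : ∀ v w x → InSpan (pair v w) x → InSpan (pair w v) x
  span-swap v w x (a , x≈) = a' , λ i →
    trans (x≈ i) (trans (lincomb-pair a v w i) (trans (+-comm _ _) (sym (lincomb-pair a' w v i))))
    where
    a' : Coord 2
    a' zero    = a (suc zero)
    a' (suc _) = a zero

  span-cong : ∀ {v w v' w'} → v ≈ⱽ v' → w ≈ⱽ w' → ∀ x → InSpan (pair v w) x → InSpan (pair v' w') x
  span-cong {v} {w} {v'} {w'} v≈v' w≈w' x (a , x≈) = a , λ i →
    trans (x≈ i) (trans (lincomb-pair a v w i)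
      (trans (+-cong (*-congˡ (v≈v' i)) (*-congˡ (w≈w' i))) (sym (lincomb-pair a v' w' i))))

  DimSpan-cong : ∀ {k v w v' w'} → v ≈ⱽ v' → w ≈ⱽ w' → DimSpan (pair v w) k → DimSpan (pair v' w') k
  DimSpan-cong v≈v' w≈w' (B , B-indep , span⇔B) = B , B-indep , λ x → mk⇔
    (Equivalence.to (span⇔B x) ∘ span-cong (≈ⱽ-sym v≈v') (≈ⱽ-sym w≈w') x)
    (span-cong v≈v' w≈w' x ∘ Equivalence.from (span⇔B x))

  span-proportional : ∀ {v w λ'} → w ≈ⱽ (λ' · v) → ∀ {x} → InSpan (pair v w) x →
                      Σ Carrier λ μ → x ≈ⱽ (μ · v)
  span-proportional {v} {w} {λ'} w≈λv {x} (a , x≈) = a zero + a (suc zero) * λ' , λ i → begin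
    x i                                          ≈⟨ x≈ i ⟩
    lincomb a (pair v w) i                       ≈⟨ lincomb-pair a v w i ⟩
    a zero * v i + a (suc zero) * w i            ≈⟨ +-congˡ (*-congˡ (w≈λv i)) ⟩
    a zero * v i + a (suc zero) * (λ' * v i)
      ≈⟨ solve 4 (λ a₀ a₁ l x → a₀ :* x :+ a₁ :* (l :* x) := (a₀ :+ a₁ :* l) :* x)
                 refl (a zero) (a (suc zero)) λ' (v i) ⟩
    (a zero + a (suc zero) * λ') * v i           ∎

  basis∈span : (B : Fin 2 → V) → ∀ j → InSpan B (B j)
  basis∈span B zero       = left∈span (B zero) (B (suc zero))
  basis∈span B (suc zero) = right∈span (B zero) (B (suc zero))

  -- μ₁ B₀ - μ₀ B₁ = 0 forces μ₀ = 0, so B₀ = 0.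
  ¬LinIndep-multiples : ∀ {B : Fin 2 → V} {v} → (∀ j → Σ Carrier λ μ → B j ≈ⱽ (μ · v)) → ¬ LinIndep B
  ¬LinIndep-multiples {B} {v} multiple B-indep = 1≉0 (B-indep e₀ e₀≈0 zero)
    where
    μ₀ = proj₁ (multiple zero)
    μ₁ = proj₁ (multiple (suc zero))
    B₀≈ = proj₂ (multiple zero)
    B₁≈ = proj₂ (multiple (suc zero))
    e₀ = proj₁ (basis∈span B zero)
    μ : Coord 2
    μ = λ { zero → μ₁ ; (suc _) → - μ₀ }
    μ₀≈0 : μ₀ ≈ 0#
    μ₀≈0 = -x≈0⇒x≈0 (B-indep μ (λ i → begin
      μ₁ * B zero i + (- μ₀ * B (suc zero) i + 0#)   ≈⟨ +-cong (*-congˡ (B₀≈ i)) (+-congʳ (*-congˡ (B₁≈ i))) ⟩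
      μ₁ * (μ₀ * v i) + (- μ₀ * (μ₁ * v i) + 0#)
        ≈⟨ solve 3 (λ a b x → a :* (b :* x) :+ ((:- b) :* (a :* x) :+ :0) := :0) refl μ₁ μ₀ (v i) ⟩
      0#                                             ∎) (suc zero))
    e₀≈0 : lincomb e₀ B ≈ⱽ 0ⱽ
    e₀≈0 i = begin
      lincomb e₀ B i    ≈⟨ sym (proj₂ (basis∈span B zero) i) ⟩
      B zero i          ≈⟨ B₀≈ i ⟩
      μ₀ * v i          ≈⟨ *-congʳ μ₀≈0 ⟩
      0# * v i          ≈⟨ zeroˡ _ ⟩
      0#                ∎

  DimSpan-2⇒¬proportional : ∀ {v w λ'} → DimSpan (pair v w) 2 → ¬ w ≈ⱽ (λ' · v)
  DimSpan-2⇒¬proportional (B , B-indep , span⇔B) w≈λv =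
    ¬LinIndep-multiples (λ j → span-proportional w≈λv (Equivalence.from (span⇔B (B j)) (basis∈span B j)))
                        B-indep

module QuadraticSpace {c ℓ f} (F : FiniteField c ℓ (suc f)) (n : ℕ) (Q : VectorSpace.QuadraticForm F n) where
  open FiniteFieldProperties F
  open VectorSpace F n
  open LinearAlgebra F n
  open QuadraticForm Q

  q-+ : ∀ x y → q (x +ⱽ y) ≈ q x + q y + b x y
  q-+ x y = solve 3 (λ qxy qx qy → qxy := qx :+ qy :+ ((qxy :- qx) :- qy)) refl (q (x +ⱽ y)) (q x) (q y)

  q-linearCombination : ∀ α β x y → q ((α · x) +ⱽ (β · y)) ≈ (α * α) * q x + (β * β) * q y + (α * β) * b x y
  q-linearCombination α β x y =
    trans (q-+ (α · x) (β · y)) (+-cong (+-cong (q-homog α x) (q-homog β y)) b-αβ)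
    where
    b-αβ : b (α · x) (β · y) ≈ (α * β) * b x y
    b-αβ = trans (b-homˡ α x (β · y)) (trans (*-congˡ (b-homʳ β x y)) (sym (*-assoc α β _)))

  q-0- : ∀ v → q (0ⱽ -ⱽ v) ≈ q v
  q-0- v = begin
    q (0ⱽ -ⱽ v)          ≈⟨ q-cong (λ i → solve 1 (λ x → :0 :- x := (:- :1) :* x) refl (v i)) ⟩
    q ((- 1#) · v)       ≈⟨ q-homog (- 1#) v ⟩
    (- 1# * - 1#) * q v  ≈⟨ solve 1 (λ x → ((:- :1) :* (:- :1)) :* x := x) refl (q v) ⟩
    q v                  ∎

  q--0 : ∀ v → q (v -ⱽ 0ⱽ) ≈ q v
  q--0 v = q-cong (λ i → solve 1 (λ x → x :- :0 := x) refl (v i))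

  -- Polarisation: q (v - w) = q v + q w - b v w.
  isotropic⇒orthogonal : ∀ {v w} → q v ≈ 0# → q w ≈ 0# → q (v -ⱽ w) ≈ 0# → b v w ≈ 0#
  isotropic⇒orthogonal {v} {w} qv≈0 qw≈0 qv-w≈0 = -x≈0⇒x≈0 (begin
    - b v w
      ≈⟨ solve 1 (λ x → :- x := (:1 :* :1) :* :0 :+ ((:- :1) :* (:- :1)) :* :0 :+ (:1 :* (:- :1)) :* x)
                 refl (b v w) ⟩
    (1# * 1#) * 0# + (- 1# * - 1#) * 0# + (1# * - 1#) * b v w
      ≈⟨ sym (+-congʳ (+-cong (*-congˡ qv≈0) (*-congˡ qw≈0))) ⟩
    (1# * 1#) * q v + (- 1# * - 1#) * q w + (1# * - 1#) * b v w
      ≈⟨ sym (q-linearCombination 1# (- 1#) v w) ⟩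
    q ((1# · v) +ⱽ ((- 1#) · w))
      ≈⟨ q-cong (λ i → solve 2 (λ x y → :1 :* x :+ (:- :1) :* y := x :- y) refl (v i) (w i)) ⟩
    q (v -ⱽ w)
      ≈⟨ qv-w≈0 ⟩
    0# ∎)

  span-totallyIsotropic : ∀ {v w} → q v ≈ 0# → q w ≈ 0# → q (v -ⱽ w) ≈ 0# →
                          TotallyIsotropic Q (InSpan (pair v w))
  span-totallyIsotropic {v} {w} qv≈0 qw≈0 qv-w≈0 x (a , x≈) = begin
    q x                                   ≈⟨ q-cong (≈ⱽ-trans x≈ (lincomb-pair a v w)) ⟩
    q ((a zero · v) +ⱽ (a (suc zero) · w))  ≈⟨ q-linearCombination _ _ v w ⟩
    (α * α) * q v + (β * β) * q w + (α * β) * b v w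
      ≈⟨ +-cong (+-cong (*-congˡ qv≈0) (*-congˡ qw≈0)) (*-congˡ (isotropic⇒orthogonal qv≈0 qw≈0 qv-w≈0)) ⟩
    (α * α) * 0# + (β * β) * 0# + (α * β) * 0#
      ≈⟨ solve 2 (λ α β → (α :* α) :* :0 :+ (β :* β) :* :0 :+ (α :* β) :* :0 := :0) refl α β ⟩
    0#                                    ∎
    where
    α = a zero
    β = a (suc zero)

  triangle : ∀ {k v w} → ¬ v ≈ⱽ 0ⱽ → ¬ w ≈ⱽ 0ⱽ → ¬ v ≈ⱽ w → q v ≈ 0# → q w ≈ 0# → q (v -ⱽ w) ≈ 0# →
             DimSpan (pair v w) k → Triangle Q k
  triangle {v = v} {w} v≉0 w≉0 v≉w qv≈0 qw≈0 qv-w≈0 dim =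
    v , w , (v≉0 ∘ ≈ⱽ-sym , trans (q-0- v) qv≈0) , (v≉w , qv-w≈0) , (w≉0 , trans (q--0 w) qw≈0) , dim

  module Vertices {k} (T : Triangle Q k) where
    v : V
    v = proj₁ T
    w : V
    w = proj₁ (proj₂ T)
    private
      0~v = proj₁ (proj₂ (proj₂ T))
      v~w = proj₁ (proj₂ (proj₂ (proj₂ T)))
      w~0 = proj₁ (proj₂ (proj₂ (proj₂ (proj₂ T))))
    v≉0 : ¬ v ≈ⱽ 0ⱽ
    v≉0 = proj₁ 0~v ∘ ≈ⱽ-sym
    w≉0 : ¬ w ≈ⱽ 0ⱽ
    w≉0 = proj₁ w~0
    v≉w : ¬ v ≈ⱽ w
    v≉w = proj₁ v~w
    dim : DimSpan (pair v w) k
    dim = proj₂ (proj₂ (proj₂ (proj₂ (proj₂ T))))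

    span : TISubspace Q k
    span = InSpan (pair v w) , dim ,
           span-totallyIsotropic (trans (sym (q-0- v)) (proj₂ 0~v)) (trans (sym (q--0 w)) (proj₂ w~0))
                                 (proj₂ v~w)

  span-cong-≈ᵗ : ∀ {k} {T T' : Triangle Q k} → _≈ᵗ_ Q T T' → _≈ˢ_ Q (Vertices.span T) (Vertices.span T')
  span-cong-≈ᵗ {T = v , w , _} {v' , w' , _} (inj₁ (v≈v' , w≈w')) x =
    mk⇔ (span-cong v≈v' w≈w' x) (span-cong (≈ⱽ-sym v≈v') (≈ⱽ-sym w≈w') x)
  span-cong-≈ᵗ {T = v , w , _} {v' , w' , _} (inj₂ (v≈w' , w≈v')) x =
    mk⇔ (span-swap w' v' x ∘ span-cong v≈w' w≈v' x)
        (span-swap w v x ∘ span-cong (≈ⱽ-sym w≈v') (≈ⱽ-sym v≈w') x)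

  -- A triangle (0 , v , w) of dimension k determines the totally isotropic subspace span(v , w), and
  -- inside that subspace it is determined by the coordinates of v and w in the chosen basis;
  -- Admissible describes exactly the coordinate pairs that arise.
  module TrianglesOverSubspaces {k t : ℕ} (subspaces : Counts (_≈ˢ_ Q {k}) t)
    {a} (Admissible : Coord k → Coord k → Set a)
    (admissible-nondegenerate : ∀ {x y} → Admissible x y → ¬ x ≈ᶜ 0ᶜ × ¬ y ≈ᶜ 0ᶜ × ¬ x ≈ᶜ y)
    (admissible-spanning : ∀ {x y} → Admissible x y → Spanning x y)
    (admissible-complete : ∀ {B : Fin k → V} → LinIndep B → ∀ {x y} → ¬ x ≈ᶜ 0ᶜ → ¬ y ≈ᶜ 0ᶜ → ¬ x ≈ᶜ y →
                           DimSpan (pair (lincomb x B) (lincomb y B)) k → Admissible x y)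
    where
    open Counts subspaces

    AdmissiblePairs : Set _
    AdmissiblePairs = Σ (Coord k × Coord k) (uncurry Admissible)

    basis : Fin t → Fin k → V
    basis L = proj₁ (proj₁ (proj₂ (from L)))

    basis-independent : ∀ L → LinIndep (basis L)
    basis-independent L = proj₁ (proj₂ (proj₁ (proj₂ (from L))))

    ∈⇔∈span-basis : ∀ L x → proj₁ (from L) x ⇔ InSpan (basis L) x
    ∈⇔∈span-basis L = proj₂ (proj₂ (proj₁ (proj₂ (from L))))

    q-basis : ∀ L x → q (lincomb x (basis L)) ≈ 0#
    q-basis L x = proj₂ (proj₂ (from L)) _ (Equivalence.from (∈⇔∈span-basis L _) (x , ≈ⱽ-refl))

    coordinates-unique : ∀ {L L' x x'} → L ≡ L' → lincomb x (basis L) ≈ⱽ lincomb x' (basis L') → x ≈ᶜ x'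
    coordinates-unique {L} ≡.refl = lincomb-injective (basis-independent L)

    lincomb-basis-cong : ∀ {L L' x x'} → L ≡ L' → x ≈ᶜ x' → lincomb x (basis L) ≈ⱽ lincomb x' (basis L')
    lincomb-basis-cong {L} ≡.refl = lincomb-cong (basis L)

    span⇔span-basis : ∀ L {x y} → Admissible x y → ∀ z →
                      InSpan (pair (lincomb x (basis L)) (lincomb y (basis L))) z ⇔ InSpan (basis L) z
    span⇔span-basis L {x} {y} xy z = mk⇔
      (λ (c , z≈) → (c zero ·ᶜ x) +ᶜ (c (suc zero) ·ᶜ y) , ≈ⱽ-trans z≈ (lincomb-pair-lincomb c x y (basis L)))
      (λ (c , z≈) → let (α , β , c≈) = admissible-spanning xy c in αβ α β , (λ i → begin
         z i                                                    ≈⟨ z≈ i ⟩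
         lincomb c (basis L) i                                  ≈⟨ lincomb-cong (basis L) c≈ i ⟩
         lincomb ((α ·ᶜ x) +ᶜ (β ·ᶜ y)) (basis L) i
           ≈⟨ sym (lincomb-pair-lincomb (αβ α β) x y (basis L) i) ⟩
         lincomb (αβ α β) (pair (lincomb x (basis L)) (lincomb y (basis L))) i ∎))
      where
      αβ : Carrier → Carrier → Coord 2
      αβ α β zero    = α
      αβ α β (suc _) = β

    ψ : Fin t × AdmissiblePairs → Triangle Q k
    ψ (L , (x , y) , xy) = triangle
      (lincomb-nonzero B-indep x≉0) (lincomb-nonzero B-indep y≉0)
      (x≉y ∘ lincomb-injective B-indep)
      (q-basis L x) (q-basis L y)
      (trans (q-cong (≈ⱽ-sym (lincomb-- x y (basis L)))) (q-basis L (x -ᶜ y)))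
      (basis L , B-indep , span⇔span-basis L xy)
      where
      B-indep = basis-independent L
      x≉0 = proj₁ (admissible-nondegenerate xy)
      y≉0 = proj₁ (proj₂ (admissible-nondegenerate xy))
      x≉y = proj₂ (proj₂ (admissible-nondegenerate xy))

    module Coordinates (T : Triangle Q k) where
      open Vertices T public
      L : Fin t
      L = to span
      ∈span⇒∈span-basis : ∀ z → InSpan (pair v w) z → InSpan (basis L) z
      ∈span⇒∈span-basis z = Equivalence.to (∈⇔∈span-basis L z) ∘ Equivalence.from (from-to span z)
      x : Coord k
      x = proj₁ (∈span⇒∈span-basis v (left∈span v w))
      v≈ : v ≈ⱽ lincomb x (basis L)
      v≈ = proj₂ (∈span⇒∈span-basis v (left∈span v w))
      y : Coord k
      y = proj₁ (∈span⇒∈span-basis w (right∈span v w))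
      w≈ : w ≈ⱽ lincomb y (basis L)
      w≈ = proj₂ (∈span⇒∈span-basis w (right∈span v w))
      admissible : Admissible x y
      admissible = admissible-complete (basis-independent L)
        (λ x≈0 → v≉0 (≈ⱽ-trans v≈ (≈ⱽ-trans (lincomb-cong (basis L) x≈0) (lincomb-0 (basis L)))))
        (λ y≈0 → w≉0 (≈ⱽ-trans w≈ (≈ⱽ-trans (lincomb-cong (basis L) y≈0) (lincomb-0 (basis L)))))
        (λ x≈y → v≉w (≈ⱽ-trans v≈ (≈ⱽ-trans (lincomb-cong (basis L) x≈y) (≈ⱽ-sym w≈))))
        (DimSpan-cong v≈ w≈ dim)

    φ : Triangle Q k → Fin t × AdmissiblePairs
    φ T = L , (x , y) , admissible
      where open Coordinates T

    _~_ : Rel (Fin t × AdmissiblePairs) _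
    _~_ = Pointwise _≡_ (Unordered _≈ᶜ_ on proj₁)

    φ-cong : ∀ {T T'} → _≈ᵗ_ Q T T' → φ T ~ φ T'
    φ-cong {T} {T'} T≈T' = L≡L' , coordinates-cong T≈T'
      where
      module A = Coordinates T
      module B = Coordinates T'
      L≡L' : A.L ≡ B.L
      L≡L' = to-cong (span-cong-≈ᵗ {T = T} {T'} T≈T')
      coordinates-≈ : ∀ {x x' u u'} → u ≈ⱽ lincomb x (basis A.L) → u' ≈ⱽ lincomb x' (basis B.L) →
                      u ≈ⱽ u' → x ≈ᶜ x'
      coordinates-≈ u≈ u'≈ u≈u' = coordinates-unique L≡L' (≈ⱽ-trans (≈ⱽ-sym u≈) (≈ⱽ-trans u≈u' u'≈))
      coordinates-cong : _≈ᵗ_ Q T T' → Unordered _≈ᶜ_ (A.x , A.y) (B.x , B.y)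
      coordinates-cong (inj₁ (v≈v' , w≈w')) = inj₁ (coordinates-≈ A.v≈ B.v≈ v≈v' , coordinates-≈ A.w≈ B.w≈ w≈w')
      coordinates-cong (inj₂ (v≈w' , w≈v')) = inj₂ (coordinates-≈ A.v≈ B.w≈ v≈w' , coordinates-≈ A.w≈ B.v≈ w≈v')

    φ∘ψ : ∀ u → φ (ψ u) ~ u
    φ∘ψ u@(L , (x , y) , xy) =
      L'≡L , inj₁ (coordinates-unique L'≡L (≈ⱽ-sym C.v≈) , coordinates-unique L'≡L (≈ⱽ-sym C.w≈))
      where
      module C = Coordinates (ψ u)
      L'≡L : C.L ≡ L
      L'≡L = ≡.trans (to-cong (λ z → ⇔.trans (span⇔span-basis L xy z) (⇔.sym (∈⇔∈span-basis L z)))) (to-from L)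

    ψ∘φ : ∀ {T u} → u ~ φ T → _≈ᵗ_ Q (ψ u) T
    ψ∘φ {T} (L≡ , inj₁ (x≈ , y≈)) = inj₁ (≈ⱽ-trans (lincomb-basis-cong L≡ x≈) (≈ⱽ-sym C.v≈) ,
                                          ≈ⱽ-trans (lincomb-basis-cong L≡ y≈) (≈ⱽ-sym C.w≈))
      where module C = Coordinates T
    ψ∘φ {T} (L≡ , inj₂ (x≈ , y≈)) = inj₂ (≈ⱽ-trans (lincomb-basis-cong L≡ x≈) (≈ⱽ-sym C.w≈) ,
                                          ≈ⱽ-trans (lincomb-basis-cong L≡ y≈) (≈ⱽ-sym C.v≈))
      where module C = Coordinates T

    Counts-triangles : ∀ {m} → Counts {A = AdmissiblePairs} (Unordered _≈ᶜ_ on proj₁) m →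
                       Counts (_≈ᵗ_ Q {k}) (t ℕ.* m)
    Counts-triangles C =
      Counts-transfer φ ψ (λ {T} {T'} → φ-cong {T} {T'}) φ∘ψ (λ {T} {u} → ψ∘φ {T} {u}) (Counts-× Counts-Fin C)

module TriangleCounts {c ℓ f} (F : FiniteField c ℓ (suc f)) (n : ℕ) (Q : VectorSpace.QuadraticForm F n) where
  open FiniteFieldProperties F
  open Plane F
  open VectorSpace F n
  open LinearAlgebra F n
  open QuadraticSpace F n Q

  Counts-triangles₁ : ∀ {t} → Counts (_≈ˢ_ Q {1}) t → Counts (_≈ᵗ_ Q {1}) (t ℕ.* choose2 f)
  Counts-triangles₁ subspaces =
    TrianglesOverSubspaces.Counts-triangles subspaces (λ x y → ¬ x ≈ᶜ 0ᶜ × ¬ y ≈ᶜ 0ᶜ × ¬ x ≈ᶜ y)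
      (λ xy → xy) spanning (λ _ x≉0 y≉0 x≉y _ → x≉0 , y≉0 , x≉y) Counts-distinctNonzeroPairs
    where
    spanning : ∀ {x y : Coord 1} → ¬ x ≈ᶜ 0ᶜ × ¬ y ≈ᶜ 0ᶜ × ¬ x ≈ᶜ y → Spanning x y
    spanning {x} {y} (x≉0 , _) z = z₀ * x₀ ⁻¹ , 0# , λ { zero → begin
      z₀                          ≈⟨ sym (*-identityʳ _) ⟩
      z₀ * 1#                     ≈⟨ *-congˡ (sym (⁻¹-inverseˡ x₀≉0)) ⟩
      z₀ * (x₀ ⁻¹ * x₀)
        ≈⟨ solve 4 (λ z i x y → z :* (i :* x) := (z :* i) :* x :+ :0 :* y) refl z₀ (x₀ ⁻¹) x₀ y₀ ⟩
      (z₀ * x₀ ⁻¹) * x₀ + 0# * y₀ ∎ }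
      where
      x₀ = x zero
      y₀ = y zero
      z₀ = z zero
      x₀≉0 : ¬ x₀ ≈ 0#
      x₀≉0 x₀≈0 = x≉0 λ { zero → x₀≈0 }

  Counts-triangles₂ : ∀ {t} → Counts (_≈ˢ_ Q {2}) t →
                      Counts (_≈ᵗ_ Q {2}) (t ℕ.* (choose2 (suc (suc f)) ℕ.* (f ℕ.* f)))
  Counts-triangles₂ subspaces =
    TrianglesOverSubspaces.Counts-triangles subspaces (λ x y → ¬ det x y ≈ 0#)
      nondegenerate det-spanning (λ {B} → complete {B}) Counts-independentPairs
    where
    nondegenerate : ∀ {x y} → ¬ det x y ≈ 0# → ¬ x ≈ᶜ 0ᶜ × ¬ y ≈ᶜ 0ᶜ × ¬ x ≈ᶜ y
    nondegenerate {x} {y} D≉0 =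
      det≉0⇒nonzeroˡ {b = y} D≉0 , det≉0⇒nonzeroʳ {x} D≉0 ,
      λ x≈y → D≉0 (trans (det-cong {a = x} (λ _ → refl) (λ i → sym (x≈y i))) (det-self x))
    complete : ∀ {B : Fin 2 → V} → LinIndep B → ∀ {x y} → ¬ x ≈ᶜ 0ᶜ → ¬ y ≈ᶜ 0ᶜ → ¬ x ≈ᶜ y →
               DimSpan (pair (lincomb x B) (lincomb y B)) 2 → ¬ det x y ≈ 0#
    complete {B} _ {x} x≉0 y≉0 _ dim D≈0 =
      let (λ' , y≈λx) = det≈0⇒proportional {x} x≉0 y≉0 D≈0 in
      DimSpan-2⇒¬proportional dim (≈ⱽ-trans (lincomb-cong B y≈λx) (lincomb-· λ' x B))

module Binomial where
  open import Data.Nat using (_+_; _*_; _∸_; _^_; _/_)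
  open import Data.Nat.Combinatorics using (_C_; nC1≡n; nCk+nC[k+1]≡[n+1]C[k+1])
  open import Data.Nat.DivMod using (m*n/n≡m)
  open import Data.Nat.Solver using (module +-*-Solver)
  open +-*-Solver
  open ≡ using (refl; sym; trans; cong; cong₂)
  open ≡.≡-Reasoning

  choose2≡C2 : ∀ m → choose2 m ≡ m C 2
  choose2≡C2 zero    = refl
  choose2≡C2 (suc m) = trans (cong₂ _+_ (sym (nC1≡n m)) (choose2≡C2 m)) (nCk+nC[k+1]≡[n+1]C[k+1] m 1)

  2*choose2 : ∀ m → 2 * choose2 (suc m) ≡ suc m * m
  2*choose2 zero    = refl
  2*choose2 (suc m) = begin
    2 * (suc m + choose2 (suc m))      ≡⟨ ℕ.*-distribˡ-+ 2 (suc m) _ ⟩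
    2 * suc m + 2 * choose2 (suc m)    ≡⟨ cong (2 * suc m +_) (2*choose2 m) ⟩
    2 * suc m + suc m * m              ≡⟨ solve 1 (λ m → con 2 :* (con 1 :+ m) :+ (con 1 :+ m) :* m
                                                         := (con 2 :+ m) :* (con 1 :+ m)) refl m ⟩
    suc (suc m) * suc m                ∎

  choose2-formula : ∀ f → choose2 (suc (suc f)) * (f * f) ≡ ((suc f ^ 2 ∸ 1) * (suc f ^ 2 ∸ suc f)) / 2
  choose2-formula f = begin
    choose2 (2 + f) * (f * f)                        ≡⟨ sym (m*n/n≡m _ 2) ⟩
    choose2 (2 + f) * (f * f) * 2 / 2                ≡⟨ cong (_/ 2) doubled ⟩
    ((suc f ^ 2 ∸ 1) * (suc f ^ 2 ∸ suc f)) / 2      ∎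
    where
    q²∸1 : suc f ^ 2 ∸ 1 ≡ f * (2 + f)
    q²∸1 = trans (cong (_∸ 1) (solve 1 (λ f → (con 1 :+ f) :^ 2 := con 1 :+ f :* (con 2 :+ f)) refl f))
                 (ℕ.m+n∸m≡n 1 _)
    q²∸q : suc f ^ 2 ∸ suc f ≡ suc f * f
    q²∸q = trans (cong (_∸ suc f) (solve 1 (λ f → (con 1 :+ f) :^ 2 := (con 1 :+ f) :+ (con 1 :+ f) :* f) refl f))
                 (ℕ.m+n∸m≡n (suc f) _)
    doubled : choose2 (2 + f) * (f * f) * 2 ≡ (suc f ^ 2 ∸ 1) * (suc f ^ 2 ∸ suc f)
    doubled = begin
      choose2 (2 + f) * (f * f) * 2          ≡⟨ solve 2 (λ c f → c :* (f :* f) :* con 2 := (con 2 :* c) :* (f :* f))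
                                                        refl (choose2 (2 + f)) f ⟩
      2 * choose2 (2 + f) * (f * f)          ≡⟨ cong (_* (f * f)) (2*choose2 (suc f)) ⟩
      (2 + f) * suc f * (f * f)              ≡⟨ solve 1 (λ f → (con 2 :+ f) :* (con 1 :+ f) :* (f :* f)
                                                             := (f :* (con 2 :+ f)) :* ((con 1 :+ f) :* f)) refl f ⟩
      (f * (2 + f)) * (suc f * f)            ≡⟨ sym (cong₂ _*_ q²∸1 q²∸q) ⟩
      (suc f ^ 2 ∸ 1) * (suc f ^ 2 ∸ suc f)  ∎

open Binomial

open import Data.Nat using (_*_; _∸_; _^_; _/_)
open import Data.Nat.Combinatorics using (_C_)

lemma4p4 : ∀ {c ℓ : Level} {f : ℕ} (F : FiniteField c ℓ f) (n : ℕ)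
    (Q : VectorSpace.QuadraticForm F n) →
    VectorSpace.NonDegenerate F n Q → VectorSpace.Isotropic F n Q →
    ∀ (t₁ t₂ c₁ c₂ : ℕ) →
    Counts (VectorSpace._≈ˢ_ F n Q {1}) t₁ →
    Counts (VectorSpace._≈ˢ_ F n Q {2}) t₂ →
    Counts (VectorSpace._≈ᵗ_ F n Q {1}) c₁ →
    Counts (VectorSpace._≈ᵗ_ F n Q {2}) c₂ →
    (c₁ ≡ t₁ * ((f ∸ 1) C 2)) × (c₂ ≡ t₂ * (((f ^ 2 ∸ 1) * (f ^ 2 ∸ f)) / 2))
lemma4p4 {f = zero} F _ _ _ _ _ _ _ _ _ _ _ _ with Counts.to (FiniteField.finite F) (FiniteField.0# F)
... | ()
lemma4p4 {f = suc f} F n Q _ _ t₁ t₂ c₁ c₂ subspaces₁ subspaces₂ triangles₁ triangles₂ =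
  ≡.trans (Counts-unique triangles₁ (Counts-triangles₁ subspaces₁)) (≡.cong (t₁ *_) (choose2≡C2 f)) ,
  ≡.trans (Counts-unique triangles₂ (Counts-triangles₂ subspaces₂)) (≡.cong (t₂ *_) (choose2-formula f))
  where open TriangleCounts F n Q
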